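{- Let $f$ be a $q$-regular sequence with a zero-insensitive linear representation $(\mathbf{u},(M_i)_{0\le i<q},\mathbf{v})$ of dimension $d$, and let $r$ be a nonnegative integer. Let $U$ be the smallest vector space such that all vectors $\mathbf{u}^tM_{n_1}\cdots M_{n_m}$ (for all $m\ge0$ and all $n_1,\dots,n_m\in\{0,\dots,q-1\}$) lie in the affine subspace $\mathbf{u}^t+U^t$, where $U^t=\{\mathbf{x}^t:\mathbf{x}\in U\}$, and let $V$ be the smallest vector space such that all vectors $M_{n_1}\cdots M_{n_m}\mathbf{v}$ lie in $\mathbf{v}+V$. Then $f$ is $q$-quasiadditive with parameter $r$ if and only if all of the following hold: (i) $\mathbf{u}^t\mathbf{v}=0$; (ii) $\mathbf{x}^t(M_0^r-I)\mathbf{v}=0$ for all $\mathbf{x}\in U$; (iii) $\mathbf{u}^t(M_0^r-I)\mathbf{y}=0$ for all $\mathbf{y}\in V$; (iv) $\mathbf{x}^tM_0^r\mathbf{y}=0$ for all $\mathbf{x}\in U$ and $\mathbf{y}\in V$.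
   Context: $f$ is $q$-quasiadditive with parameter $r$ if $f(q^{k+r}a+b)=f(a)+f(b)$ for all nonnegative integers $a,b,k$ with $0\le b<q^k$. A linear representation of $f$ is a triple $(\mathbf{u},(M_i)_{0\le i<q},\mathbf{v})$ of vectors $\mathbf{u},\mathbf{v}$ of dimension $d$ and $d\times d$ matrices $M_i$ such that $f(n)=\mathbf{u}^tM_{n_0}M_{n_1}\cdots M_{n_L}\mathbf{v}$ for every $n$, where $n_L\cdots n_0$ is the $q$-ary expansion of $n$ (empty product for $n=0$); $f$ is $q$-regular if it has a linear representation. It is zero-insensitive if $M_0\mathbf{v}=\mathbf{v}$. $I$ is the $d\times d$ identity matrix. -}

module Defs where

open import Level using (Level; _⊔_) renaming (suc to lsuc)
open import Data.Nat using (ℕ; zero; suc; _≤_; _<_; s≤s; z≤n; NonZero)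
import Data.Nat as N
open import Data.Nat.DivMod using (_/_; _mod_)
open import Data.Fin using (Fin; fromℕ<; _≟_)
import Data.Fin as Fin
open import Relation.Nullary using (yes; no)
open import Data.List using (List; []; _∷_)
open import Data.Product using (_×_; _,_; ∃)
open import Relation.Nullary using (¬_)
open import Algebra.Bundles using (CommutativeRing)

record Field c ℓ : Set (lsuc (c ⊔ ℓ)) where
  field
    commutativeRing : CommutativeRing c ℓ
  open CommutativeRing commutativeRing public
  field
    0≉1     : ¬ (0# ≈ 1#)
    inverse : ∀ x → ¬ (x ≈ 0#) → ∃ λ y → x * y ≈ 1#

-- q-ary digits (least significant first), for q ≥ 2.
-- digits q _ 0 = [] ; otherwise n₀ ∷ n₁ ∷ … ∷ n_L with n_L ≠ 0.

nonZero≥2 : ∀ {q} → 2 ≤ q → NonZero q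
nonZero≥2 {suc _} _ = record {}

digitsFuel : (q : ℕ) → .{{NonZero q}} → ℕ → ℕ → List (Fin q)
digitsFuel q zero    n       = []
digitsFuel q (suc k) zero    = []
digitsFuel q (suc k) (suc n) = (suc n mod q) ∷ digitsFuel q k (suc n / q)

-- the fuel n suffices since n has at most n digits
digits : (q : ℕ) → 2 ≤ q → ℕ → List (Fin q)
digits q q≥2 n = digitsFuel q {{nonZero≥2 q≥2}} n n

zeroDigit : (q : ℕ) → 2 ≤ q → Fin q
zeroDigit q q≥2 = fromℕ< {0} {q} (q≥2' q≥2)
  where
  q≥2' : ∀ {q} → 2 ≤ q → 0 < q
  q≥2' (s≤s _) = s≤s z≤n

module LinAlg {c ℓ} (R : CommutativeRing c ℓ) where
  open CommutativeRing R renaming (Carrier to K)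

  Vector : ℕ → Set c
  Vector d = Fin d → K

  Matrix : ℕ → Set c
  Matrix d = Fin d → Fin d → K

  ∑ : (d : ℕ) → (Fin d → K) → K
  ∑ zero    g = 0#
  ∑ (suc d) g = g Fin.zero + ∑ d (λ i → g (Fin.suc i))

  _≋_ : ∀ {d} → Vector d → Vector d → Set ℓ
  x ≋ y = ∀ i → x i ≈ y i

  _·_ : ∀ {d} → Vector d → Vector d → K
  _·_ {d} x y = ∑ d (λ i → x i * y i)

  _⊕_ _⊖_ : ∀ {d} → Vector d → Vector d → Vector d
  (x ⊕ y) i = x i + y i
  (x ⊖ y) i = x i - y i

  zeroV : ∀ {d} → Vector d
  zeroV _ = 0#

  _•_ : ∀ {d} → K → Vector d → Vector d
  (a • x) i = a * x i

  _*ᵛ_ : ∀ {d} → Matrix d → Vector d → Vector d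
  _*ᵛ_ {d} A y i = ∑ d (λ j → A i j * y j)

  _ᵛ*_ : ∀ {d} → Vector d → Matrix d → Vector d
  _ᵛ*_ {d} x A j = ∑ d (λ i → x i * A i j)

  idM : ∀ {d} → Matrix d
  idM i j with i ≟ j
  ... | yes _ = 1#
  ... | no _  = 0#

  _⊗_ : ∀ {d} → Matrix d → Matrix d → Matrix d
  _⊗_ {d} A B i j = ∑ d (λ k → A i k * B k j)

  _⊟_ : ∀ {d} → Matrix d → Matrix d → Matrix d
  (A ⊟ B) i j = A i j - B i j

  _^ᴹ_ : ∀ {d} → Matrix d → ℕ → Matrix d
  A ^ᴹ zero  = idM
  A ^ᴹ suc n = A ⊗ (A ^ᴹ n)

  module Words {q d : ℕ} (M : Fin q → Matrix d) where

    colMul : List (Fin q) → Vector d → Vector d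
    colMul []      y = y
    colMul (a ∷ w) y = M a *ᵛ colMul w y

    rowMul : Vector d → List (Fin q) → Vector d
    rowMul x []      = x
    rowMul x (a ∷ w) = rowMul (x ᵛ* M a) w

    lincomb : List (K × Vector d) → Vector d
    lincomb []             = zeroV
    lincomb ((a , z) ∷ cs) = (a • z) ⊕ lincomb cs

    mapL : ∀ {A B : Set c} → (A → B) → List A → List B
    mapL f []       = []
    mapL f (x ∷ xs) = f x ∷ mapL f xs

    -- U = span { uᵗ M_w − uᵗ : w word } : the smallest vector space U
    -- with all uᵗ M_w ∈ uᵗ + Uᵗ.  x ∈ U iff x is a finite linear
    -- combination of such differences.
    InU : Vector d → Vector d → Set (c ⊔ ℓ)
    InU u x = ∃ λ (cs : List (K × List (Fin q))) →
      x ≋ lincomb (mapL (λ { (a , w) → (a , (rowMul u w ⊖ u)) }) cs)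

    -- V = span { M_w v − v : w word }
    InV : Vector d → Vector d → Set (c ⊔ ℓ)
    InV v y = ∃ λ (cs : List (K × List (Fin q))) →
      y ≋ lincomb (mapL (λ { (a , w) → (a , (colMul w v ⊖ v)) }) cs)

  QuasiAdditive : (q : ℕ) → (ℕ → K) → ℕ → Set ℓ
  QuasiAdditive q f r =
    ∀ (a b k : ℕ) → b < q N.^ k → f (q N.^ (k N.+ r) N.* a N.+ b) ≈ f a + f b

-- Zero-insensitivity lets trailing zero digits be dropped, so f (value w) = uᵗ M_w v for every
-- digit word w.  As q^(k+r) a + b is the value of the word w₁ 0^r w₂, where w₁ is the k-digit
-- expansion of b and w₂ that of a, quasi-additivity amounts to
--   uᵗ M_{w₁} Z M_{w₂} v = uᵗ M_{w₁} v + uᵗ M_{w₂} v   for all words w₁, w₂, with Z = M₀^r.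
-- Writing uᵗ M_{w₁} = uᵗ + xᵗ and M_{w₂} v = v + y and using Z v = v, the difference of the two
-- sides is xᵗ Z y + uᵗ (Z − I) y − uᵗ v.  Empty words give (i), an empty w₁ then gives (iii), and
-- arbitrary words give (iv), first on the generators of U and V and then on U and V by linearity;
-- (ii) holds outright because (Z − I) v = 0.

module Submission where

open import Defs
open import Level using (_⊔_)
open import Data.Nat using (ℕ; zero; suc; _≤_; s≤s; z≤n)
import Data.Nat as ℕ
open import Data.Fin using (Fin; zero; suc; toℕ)
open import Data.Fin.Properties using (_≟_)
open import Data.Product using (_×_; _,_; proj₁; proj₂)
open import Data.List using (List; []; _∷_; _++_; length; replicate)
open import Data.Digit using (fromDigits)
open import Relation.Nullary using (yes; no)
open import Relation.Binary.PropositionalEquality as ≡ using (_≡_)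
open import Algebra.Bundles using (CommutativeRing)
open import Function.Bundles using (_⇔_; mk⇔)
open import Function.Construct.Composition using (_⇔-∘_)

module MatrixAlgebra {c ℓ} (R : CommutativeRing c ℓ) where
  open CommutativeRing R hiding (zero) renaming (Carrier to K)
  open LinAlg R
  open import Algebra.Properties.Ring ring using (-1*x≈-x; x[y-z]≈xy-xz; [y-z]x≈yx-zx; x+x≈x⇒x≈0)
  open import Algebra.Properties.CommutativeSemigroup +-commutativeSemigroup
    using () renaming (interchange to +-interchange)
  open import Algebra.Properties.CommutativeSemigroup *-commutativeSemigroup
    using () renaming (x∙yz≈y∙xz to *-x∙yz≈y∙xz)
  open import Data.Vec.Functional.Relation.Binary.Equality.Setoid setoid
    using (≋-refl; ≋-sym; ≋-trans)
  open import Algebra.Properties.Group +-group using (x∙y⁻¹≈ε⇒x≈y; x≈y⇒x∙y⁻¹≈ε; ε⁻¹≈ε; //-rightDividesˡ)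
  open import Algebra.Properties.AbelianGroup +-abelianGroup using (xyx⁻¹≈y)
  open import Relation.Binary.Reasoning.Setoid setoid

  ∑-cong : ∀ d {g h : Fin d → K} → (∀ i → g i ≈ h i) → ∑ d g ≈ ∑ d h
  ∑-cong zero    g≈h = refl
  ∑-cong (suc d) g≈h = +-cong (g≈h zero) (∑-cong d (λ i → g≈h (suc i)))

  ∑-zero : ∀ d → ∑ d (λ _ → 0#) ≈ 0#
  ∑-zero zero    = refl
  ∑-zero (suc d) = trans (+-cong refl (∑-zero d)) (+-identityˡ 0#)

  ∑-distrib-+ : ∀ d (g h : Fin d → K) → ∑ d (λ i → g i + h i) ≈ ∑ d g + ∑ d h
  ∑-distrib-+ zero    g h = sym (+-identityˡ 0#)
  ∑-distrib-+ (suc d) g h =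
    trans (+-cong refl (∑-distrib-+ d _ _)) (+-interchange _ _ _ _)

  *-distribˡ-∑ : ∀ d a (g : Fin d → K) → a * ∑ d g ≈ ∑ d (λ i → a * g i)
  *-distribˡ-∑ zero    a g = zeroʳ a
  *-distribˡ-∑ (suc d) a g = trans (distribˡ a _ _) (+-cong refl (*-distribˡ-∑ d a _))

  *-distribʳ-∑ : ∀ d a (g : Fin d → K) → ∑ d g * a ≈ ∑ d (λ i → g i * a)
  *-distribʳ-∑ d a g =
    trans (*-comm _ a) (trans (*-distribˡ-∑ d a g) (∑-cong d (λ i → *-comm a (g i))))

  ∑-distrib-- : ∀ d (g h : Fin d → K) → ∑ d (λ i → g i - h i) ≈ ∑ d g - ∑ d h
  ∑-distrib-- d g h = begin
    ∑ d (λ i → g i - h i)          ≈⟨ ∑-distrib-+ d g _ ⟩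
    ∑ d g + ∑ d (λ i → - h i)      ≈⟨ +-cong refl (∑-cong d (λ i → sym (-1*x≈-x (h i)))) ⟩
    ∑ d g + ∑ d (λ i → - 1# * h i) ≈⟨ +-cong refl (sym (*-distribˡ-∑ d (- 1#) h)) ⟩
    ∑ d g + - 1# * ∑ d h           ≈⟨ +-cong refl (-1*x≈-x _) ⟩
    ∑ d g - ∑ d h                  ∎

  ∑-comm : ∀ d e (g : Fin d → Fin e → K) →
           ∑ d (λ i → ∑ e (g i)) ≈ ∑ e (λ j → ∑ d (λ i → g i j))
  ∑-comm zero    e g = sym (∑-zero e)
  ∑-comm (suc d) e g =
    trans (+-cong refl (∑-comm d e (λ i → g (suc i)))) (sym (∑-distrib-+ e _ _))

  idM-suc : ∀ {d} (i j : Fin d) → idM (suc i) (suc j) ≡ idM i j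
  idM-suc i j with i ≟ j
  ... | yes _ = ≡.refl
  ... | no _  = ≡.refl

  idM-row : ∀ d (i : Fin d) (y : Vector d) → ∑ d (λ j → idM i j * y j) ≈ y i
  idM-row (suc d) zero y = begin
    1# * y zero + ∑ d (λ j → 0# * y (suc j)) ≈⟨ +-cong (*-identityˡ _) (∑-cong d (λ j → zeroˡ _)) ⟩
    y zero + ∑ d (λ _ → 0#)                  ≈⟨ +-cong refl (∑-zero d) ⟩
    y zero + 0#                              ≈⟨ +-identityʳ _ ⟩
    y zero                                   ∎
  idM-row (suc d) (suc i) y = begin
    0# * y zero + ∑ d (λ j → idM (suc i) (suc j) * y (suc j))
      ≈⟨ +-cong (zeroˡ _) (∑-cong d (λ j → *-cong (reflexive (idM-suc i j)) refl)) ⟩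
    0# + ∑ d (λ j → idM i j * y (suc j)) ≈⟨ +-identityˡ _ ⟩
    ∑ d (λ j → idM i j * y (suc j))      ≈⟨ idM-row d i (λ j → y (suc j)) ⟩
    y (suc i)                            ∎

  module _ {d : ℕ} where

    ·-cong : {x x′ y y′ : Vector d} → x ≋ x′ → y ≋ y′ → x · y ≈ x′ · y′
    ·-cong x≋x′ y≋y′ = ∑-cong d (λ i → *-cong (x≋x′ i) (y≋y′ i))

    ·-distribˡ-⊕ : (x y z : Vector d) → x · (y ⊕ z) ≈ x · y + x · z
    ·-distribˡ-⊕ x y z = trans (∑-cong d (λ i → distribˡ (x i) (y i) (z i))) (∑-distrib-+ d _ _)

    ·-distribʳ-⊕ : (x y z : Vector d) → (x ⊕ y) · z ≈ x · z + y · z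
    ·-distribʳ-⊕ x y z = trans (∑-cong d (λ i → distribʳ (z i) (x i) (y i))) (∑-distrib-+ d _ _)

    ·-distribˡ-⊖ : (x y z : Vector d) → x · (y ⊖ z) ≈ x · y - x · z
    ·-distribˡ-⊖ x y z = trans (∑-cong d (λ i → x[y-z]≈xy-xz (x i) (y i) (z i))) (∑-distrib-- d _ _)

    ·-distribʳ-⊖ : (x y z : Vector d) → (x ⊖ y) · z ≈ x · z - y · z
    ·-distribʳ-⊖ x y z = trans (∑-cong d (λ i → [y-z]x≈yx-zx (z i) (x i) (y i))) (∑-distrib-- d _ _)

    ·-•ˡ : (a : K) (x y : Vector d) → (a • x) · y ≈ a * (x · y)
    ·-•ˡ a x y = trans (∑-cong d (λ i → *-assoc a (x i) (y i))) (sym (*-distribˡ-∑ d a _))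

    ·-•ʳ : (a : K) (x y : Vector d) → x · (a • y) ≈ a * (x · y)
    ·-•ʳ a x y = trans (∑-cong d (λ i → *-x∙yz≈y∙xz (x i) a (y i))) (sym (*-distribˡ-∑ d a _))

    *ᵛ-cong : (A : Matrix d) {y y′ : Vector d} → y ≋ y′ → (A *ᵛ y) ≋ (A *ᵛ y′)
    *ᵛ-cong A y≋y′ i = ·-cong {x = A i} ≋-refl y≋y′

    ·-*ᵛ-distrib-⊕ : (x : Vector d) (A : Matrix d) (y z : Vector d) →
                     x · (A *ᵛ (y ⊕ z)) ≈ x · (A *ᵛ y) + x · (A *ᵛ z)
    ·-*ᵛ-distrib-⊕ x A y z = trans (·-cong ≋-refl (λ i → ·-distribˡ-⊕ (A i) y z)) (·-distribˡ-⊕ x _ _)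

    ·-*ᵛ-distrib-⊖ : (x : Vector d) (A : Matrix d) (y z : Vector d) →
                     x · (A *ᵛ (y ⊖ z)) ≈ x · (A *ᵛ y) - x · (A *ᵛ z)
    ·-*ᵛ-distrib-⊖ x A y z = trans (·-cong ≋-refl (λ i → ·-distribˡ-⊖ (A i) y z)) (·-distribˡ-⊖ x _ _)

    ·-*ᵛ-• : (x : Vector d) (A : Matrix d) (a : K) (y : Vector d) →
             x · (A *ᵛ (a • y)) ≈ a * (x · (A *ᵛ y))
    ·-*ᵛ-• x A a y = trans (·-cong ≋-refl (λ i → ·-•ʳ a (A i) y)) (·-•ʳ a x _)

    idM-*ᵛ : (y : Vector d) → (idM *ᵛ y) ≋ y
    idM-*ᵛ y i = idM-row d i y

    ·-⊟idM-*ᵛ : (x : Vector d) (A : Matrix d) (y : Vector d) →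
                x · ((A ⊟ idM) *ᵛ y) ≈ x · (A *ᵛ y) - x · y
    ·-⊟idM-*ᵛ x A y = begin
      x · ((A ⊟ idM) *ᵛ y)   ≈⟨ ·-cong ≋-refl (≋-trans ⊟-*ᵛ (λ i → +-cong refl (-‿cong (idM-*ᵛ y i)))) ⟩
      x · ((A *ᵛ y) ⊖ y)     ≈⟨ ·-distribˡ-⊖ x _ y ⟩
      x · (A *ᵛ y) - x · y   ∎
      where
      ⊟-*ᵛ : ((A ⊟ idM) *ᵛ y) ≋ ((A *ᵛ y) ⊖ (idM *ᵛ y))
      ⊟-*ᵛ i = trans (∑-cong d (λ j → [y-z]x≈yx-zx (y j) (A i j) (idM i j))) (∑-distrib-- d _ _)

    ⊗-*ᵛ : (A B : Matrix d) (y : Vector d) → ((A ⊗ B) *ᵛ y) ≋ (A *ᵛ (B *ᵛ y))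
    ⊗-*ᵛ A B y i = begin
      ∑ d (λ j → ∑ d (λ k → A i k * B k j) * y j)   ≈⟨ ∑-cong d (λ j → *-distribʳ-∑ d (y j) _) ⟩
      ∑ d (λ j → ∑ d (λ k → (A i k * B k j) * y j)) ≈⟨ ∑-comm d d _ ⟩
      ∑ d (λ k → ∑ d (λ j → (A i k * B k j) * y j)) ≈⟨ ∑-cong d (λ k → ∑-cong d (λ j → *-assoc _ _ _)) ⟩
      ∑ d (λ k → ∑ d (λ j → A i k * (B k j * y j))) ≈⟨ ∑-cong d (λ k → sym (*-distribˡ-∑ d (A i k) _)) ⟩
      ∑ d (λ k → A i k * ∑ d (λ j → B k j * y j))   ∎

    ᵛ*-·-assoc : (x : Vector d) (A : Matrix d) (y : Vector d) → (x ᵛ* A) · y ≈ x · (A *ᵛ y)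
    ᵛ*-·-assoc x A y = begin
      ∑ d (λ j → ∑ d (λ i → x i * A i j) * y j)   ≈⟨ ∑-cong d (λ j → *-distribʳ-∑ d (y j) _) ⟩
      ∑ d (λ j → ∑ d (λ i → (x i * A i j) * y j)) ≈⟨ ∑-comm d d _ ⟩
      ∑ d (λ i → ∑ d (λ j → (x i * A i j) * y j)) ≈⟨ ∑-cong d (λ i → ∑-cong d (λ j → *-assoc _ _ _)) ⟩
      ∑ d (λ i → ∑ d (λ j → x i * (A i j * y j))) ≈⟨ ∑-cong d (λ i → sym (*-distribˡ-∑ d (x i) _)) ⟩
      ∑ d (λ i → x i * ∑ d (λ j → A i j * y j))   ∎

    ^ᴹ-fixes : (A : Matrix d) {y : Vector d} → (A *ᵛ y) ≋ y → ∀ n → ((A ^ᴹ n) *ᵛ y) ≋ y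
    ^ᴹ-fixes A Ay≋y zero    = idM-*ᵛ _
    ^ᴹ-fixes A Ay≋y (suc n) = ≋-trans (⊗-*ᵛ A _ _) (≋-trans (*ᵛ-cong A (^ᴹ-fixes A Ay≋y n)) Ay≋y)

    record IsLinear (φ : Vector d → K) : Set (c ⊔ ℓ) where
      field
        resp-≋ : ∀ {x y} → x ≋ y → φ x ≈ φ y
        homo-⊕ : ∀ x y → φ (x ⊕ y) ≈ φ x + φ y
        homo-• : ∀ a x → φ (a • x) ≈ a * φ x

      homo-zeroV : φ zeroV ≈ 0#
      homo-zeroV = x+x≈x⇒x≈0 _ (trans (sym (homo-⊕ zeroV zeroV)) (resp-≋ (λ _ → +-identityʳ 0#)))

    ·-linearˡ : (y : Vector d) → IsLinear (λ x → x · y)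
    ·-linearˡ y = record
      { resp-≋ = λ x≋x′ → ·-cong x≋x′ ≋-refl
      ; homo-⊕ = λ x z → ·-distribʳ-⊕ x z y
      ; homo-• = λ a x → ·-•ˡ a x y
      }

    ·-*ᵛ-linearʳ : (x : Vector d) (A : Matrix d) → IsLinear (λ y → x · (A *ᵛ y))
    ·-*ᵛ-linearʳ x A = record
      { resp-≋ = λ y≋y′ → ·-cong ≋-refl (*ᵛ-cong A y≋y′)
      ; homo-⊕ = ·-*ᵛ-distrib-⊕ x A
      ; homo-• = λ a y → ·-*ᵛ-• x A a y
      }

  module WordAlgebra {q d : ℕ} (M : Fin q → Matrix d) where
    open Words M

    colMul-cong : ∀ w {y y′ : Vector d} → y ≋ y′ → colMul w y ≋ colMul w y′
    colMul-cong []      y≋y′ = y≋y′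
    colMul-cong (a ∷ w) y≋y′ = *ᵛ-cong (M a) (colMul-cong w y≋y′)

    colMul-++ : ∀ w₁ w₂ (y : Vector d) → colMul (w₁ ++ w₂) y ≡ colMul w₁ (colMul w₂ y)
    colMul-++ []       w₂ y = ≡.refl
    colMul-++ (a ∷ w₁) w₂ y = ≡.cong (M a *ᵛ_) (colMul-++ w₁ w₂ y)

    colMul-replicate : ∀ n a (y : Vector d) → colMul (replicate n a) y ≋ ((M a ^ᴹ n) *ᵛ y)
    colMul-replicate zero    a y = ≋-sym (idM-*ᵛ y)
    colMul-replicate (suc n) a y =
      ≋-trans (*ᵛ-cong (M a) (colMul-replicate n a y)) (≋-sym (⊗-*ᵛ (M a) _ y))

    rowMul-· : ∀ w (x y : Vector d) → rowMul x w · y ≈ x · colMul w y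
    rowMul-· []      x y = refl
    rowMul-· (a ∷ w) x y = trans (rowMul-· w (x ᵛ* M a) y) (ᵛ*-·-assoc x (M a) (colMul w y))

    lincomb-vanishes : ∀ {φ} → IsLinear φ → (g : K × List (Fin q) → K × Vector d) →
                       (∀ p → φ (proj₂ (g p)) ≈ 0#) → ∀ cs → φ (lincomb (mapL g cs)) ≈ 0#
    lincomb-vanishes φ-lin g φ∘g≈0 []       = IsLinear.homo-zeroV φ-lin
    lincomb-vanishes {φ} φ-lin g φ∘g≈0 (p ∷ cs) = begin
      φ (lincomb (mapL g (p ∷ cs)))            ≈⟨ homo-⊕ _ _ ⟩
      φ (proj₁ (g p) • proj₂ (g p)) + φ (lincomb (mapL g cs))
                                               ≈⟨ +-cong (trans (homo-• _ _) (*-cong refl (φ∘g≈0 p)))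
                                                         (lincomb-vanishes φ-lin g φ∘g≈0 cs) ⟩
      proj₁ (g p) * 0# + 0#                    ≈⟨ trans (+-identityʳ _) (zeroʳ _) ⟩
      0#                                       ∎
      where open IsLinear φ-lin

    InU-vanishes : ∀ {φ} (u : Vector d) → IsLinear φ → (∀ w → φ (rowMul u w ⊖ u) ≈ 0#) →
                   ∀ {x} → InU u x → φ x ≈ 0#
    InU-vanishes u φ-lin φ-gen (cs , x≋) =
      trans (IsLinear.resp-≋ φ-lin x≋) (lincomb-vanishes φ-lin _ (λ (_ , w) → φ-gen w) cs)

    InV-vanishes : ∀ {φ} (v : Vector d) → IsLinear φ → (∀ w → φ (colMul w v ⊖ v) ≈ 0#) →
                   ∀ {y} → InV v y → φ y ≈ 0#
    InV-vanishes v φ-lin φ-gen (cs , y≋) =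
      trans (IsLinear.resp-≋ φ-lin y≋) (lincomb-vanishes φ-lin _ (λ (_ , w) → φ-gen w) cs)

    generator-InU : ∀ (u : Vector d) w → InU u (rowMul u w ⊖ u)
    generator-InU u w = ((1# , w) ∷ []) , λ _ → sym (trans (+-identityʳ _) (*-identityˡ _))

    generator-InV : ∀ (v : Vector d) w → InV v (colMul w v ⊖ v)
    generator-InV v w = ((1# , w) ∷ []) , λ _ → sym (trans (+-identityʳ _) (*-identityˡ _))

  module WordConditions {q d : ℕ} (M : Fin q → Matrix d) (u v : Vector d)
                        (Z : Matrix d) (Zv≋v : (Z *ᵛ v) ≋ v) where
    open Words M
    open WordAlgebra M

    WordAdditive : Set ℓ
    WordAdditive = ∀ w₁ w₂ → u · colMul w₁ (Z *ᵛ colMul w₂ v) ≈ u · colMul w₁ v + u · colMul w₂ v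

    Conditions : Set (c ⊔ ℓ)
    Conditions = (u · v) ≈ 0#
               × (∀ x → InU u x → (x · ((Z ⊟ idM) *ᵛ v)) ≈ 0#)
               × (∀ y → InV v y → (u · ((Z ⊟ idM) *ᵛ y)) ≈ 0#)
               × (∀ x y → InU u x → InV v y → (x · (Z *ᵛ y)) ≈ 0#)

    x-0#≈x : ∀ x → x - 0# ≈ x
    x-0#≈x x = trans (+-cong refl ε⁻¹≈ε) (+-identityʳ x)

    ·-Z-fixes-v : ∀ x → x · (Z *ᵛ v) ≈ x · v
    ·-Z-fixes-v x = ·-cong ≋-refl Zv≋v

    Z⊟idM-annihilates-v : ∀ x → x · ((Z ⊟ idM) *ᵛ v) ≈ 0#
    Z⊟idM-annihilates-v x = trans (·-⊟idM-*ᵛ x Z v) (x≈y⇒x∙y⁻¹≈ε (·-Z-fixes-v x))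

    expand-Z : ∀ p s → (p ⊖ u) · (Z *ᵛ (s ⊖ v))
                       ≈ (p · (Z *ᵛ s) - p · v) - (u · (Z *ᵛ s) - u · v)
    expand-Z p s = trans (·-distribʳ-⊖ p u _) (+-cong (expand p) (-‿cong (expand u)))
      where
      expand : ∀ x → x · (Z *ᵛ (s ⊖ v)) ≈ x · (Z *ᵛ s) - x · v
      expand x = trans (·-*ᵛ-distrib-⊖ x Z s v) (+-cong refl (-‿cong (·-Z-fixes-v x)))

    expand-Z⊟idM : ∀ s → u · ((Z ⊟ idM) *ᵛ (s ⊖ v)) ≈ u · (Z *ᵛ s) - u · s
    expand-Z⊟idM s = begin
      u · ((Z ⊟ idM) *ᵛ (s ⊖ v))                    ≈⟨ ·-*ᵛ-distrib-⊖ u (Z ⊟ idM) s v ⟩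
      u · ((Z ⊟ idM) *ᵛ s) - u · ((Z ⊟ idM) *ᵛ v)   ≈⟨ +-cong (·-⊟idM-*ᵛ u Z s) (-‿cong (Z⊟idM-annihilates-v u)) ⟩
      (u · (Z *ᵛ s) - u · s) - 0#                   ≈⟨ x-0#≈x _ ⟩
      u · (Z *ᵛ s) - u · s                          ∎

    wordAdditive⇒conditions : WordAdditive → Conditions
    -- (ii) needs no hypothesis, as Z fixes v.
    wordAdditive⇒conditions add = u·v≈0 , (λ x _ → Z⊟idM-annihilates-v x) , cond-iii , cond-iv
      where
      u·v≈0 : u · v ≈ 0#
      u·v≈0 = x+x≈x⇒x≈0 _ (trans (sym (add [] [])) (·-Z-fixes-v u))

      u·Z-word : ∀ w → u · (Z *ᵛ colMul w v) ≈ u · colMul w v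
      u·Z-word w = trans (add [] w) (trans (+-cong u·v≈0 refl) (+-identityˡ _))

      cond-iii : ∀ y → InV v y → u · ((Z ⊟ idM) *ᵛ y) ≈ 0#
      cond-iii y = InV-vanishes v (·-*ᵛ-linearʳ u (Z ⊟ idM))
        (λ w → trans (expand-Z⊟idM _) (x≈y⇒x∙y⁻¹≈ε (u·Z-word w)))

      cond-iv-generators : ∀ w₁ w₂ → (rowMul u w₁ ⊖ u) · (Z *ᵛ (colMul w₂ v ⊖ v)) ≈ 0#
      cond-iv-generators w₁ w₂ = begin
        (p ⊖ u) · (Z *ᵛ (s ⊖ v))                          ≈⟨ expand-Z p s ⟩
        (p · (Z *ᵛ s) - p · v) - (u · (Z *ᵛ s) - u · v)   ≈⟨ +-cong (+-cong (trans (rowMul-· w₁ u _) (add w₁ w₂))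
                                                                            (-‿cong (rowMul-· w₁ u v)))
                                                                    (-‿cong (+-cong (u·Z-word w₂) (-‿cong u·v≈0))) ⟩
        ((u · colMul w₁ v + u · s) - u · colMul w₁ v) - (u · s - 0#)
                                                          ≈⟨ +-cong (xyx⁻¹≈y _ _) (-‿cong (x-0#≈x _)) ⟩
        u · s - u · s                                     ≈⟨ -‿inverseʳ _ ⟩
        0#                                                ∎
        where
        p = rowMul u w₁
        s = colMul w₂ v

      cond-iv : ∀ x y → InU u x → InV v y → x · (Z *ᵛ y) ≈ 0#
      cond-iv x y x∈U y∈V = InU-vanishes u (·-linearˡ (Z *ᵛ y))
        (λ w₁ → InV-vanishes v (·-*ᵛ-linearʳ _ Z) (cond-iv-generators w₁) y∈V) x∈U

    conditions⇒wordAdditive : Conditions → WordAdditive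
    conditions⇒wordAdditive (u·v≈0 , _ , cond-iii , cond-iv) w₁ w₂ = begin
      u · colMul w₁ (Z *ᵛ s)             ≈⟨ rowMul-· w₁ u _ ⟨
      p · (Z *ᵛ s)                       ≈⟨ //-rightDividesˡ (p · v) _ ⟨
      (p · (Z *ᵛ s) - p · v) + p · v     ≈⟨ +-cong p·Zs-p·v≈u·s (rowMul-· w₁ u v) ⟩
      u · s + u · colMul w₁ v            ≈⟨ +-comm _ _ ⟩
      u · colMul w₁ v + u · s            ∎
      where
      p = rowMul u w₁
      s = colMul w₂ v

      u·Zs≈u·s : u · (Z *ᵛ s) ≈ u · s
      u·Zs≈u·s = x∙y⁻¹≈ε⇒x≈y _ _ (trans (sym (expand-Z⊟idM s)) (cond-iii _ (generator-InV v w₂)))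

      p·Zs-p·v≈u·s : p · (Z *ᵛ s) - p · v ≈ u · s
      p·Zs-p·v≈u·s = begin
        p · (Z *ᵛ s) - p · v   ≈⟨ x∙y⁻¹≈ε⇒x≈y _ _ (trans (sym (expand-Z p s))
                                                   (cond-iv _ _ (generator-InU u w₁) (generator-InV v w₂))) ⟩
        u · (Z *ᵛ s) - u · v   ≈⟨ +-cong u·Zs≈u·s (-‿cong u·v≈0) ⟩
        u · s - 0#             ≈⟨ x-0#≈x _ ⟩
        u · s                  ∎

    wordAdditive⇔conditions : WordAdditive ⇔ Conditions
    wordAdditive⇔conditions = mk⇔ wordAdditive⇒conditions conditions⇒wordAdditive

-- Data.Digit.fromDigits reads a word least significant digit first, like Defs.digits.
module Digits (q′ : ℕ) where
  open import Data.Nat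
  open import Data.Nat.Properties
  open import Data.Nat.DivMod
  open import Data.Nat.Divisibility using (n∣m*n)
  open import Data.Nat.Base using (s≤s⁻¹)
  open import Data.Nat.Solver using (module +-*-Solver)
  open import Data.Fin.Properties using (toℕ<n; toℕ-injective; toℕ-fromℕ<)
  open ≡ using (refl; sym; trans; cong; cong₂)
  open ≡.≡-Reasoning
  open +-*-Solver using (solve; _:+_; _:*_; _:=_)

  q : ℕ
  q = 2 + q′

  q≥2 : 2 ≤ q
  q≥2 = s≤s (s≤s z≤n)

  fromDigits-bound : ∀ (w : List (Fin q)) → fromDigits w < q ^ length w
  fromDigits-bound []      = s≤s z≤n
  fromDigits-bound (a ∷ w) =
    ≤-trans (+-monoˡ-< (fromDigits w * q) (toℕ<n a))
      (≤-trans (*-monoˡ-≤ q (fromDigits-bound w)) (≤-reflexive (*-comm (q ^ length w) q)))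

  fromDigits-++ : ∀ (w₁ w₂ : List (Fin q)) →
                  fromDigits (w₁ ++ w₂) ≡ fromDigits w₁ + fromDigits w₂ * q ^ length w₁
  fromDigits-++ []       w₂ = sym (*-identityʳ (fromDigits w₂))
  fromDigits-++ (a ∷ w₁) w₂ = begin
    toℕ a + fromDigits (w₁ ++ w₂) * q                          ≡⟨ cong (λ n → toℕ a + n * q) (fromDigits-++ w₁ w₂) ⟩
    toℕ a + (fromDigits w₁ + fromDigits w₂ * q ^ length w₁) * q ≡⟨ solve 5 (λ d x y p Q →
                                                                     d :+ (x :+ y :* p) :* Q := (d :+ x :* Q) :+ y :* (Q :* p))
                                                                     refl (toℕ a) (fromDigits w₁) (fromDigits w₂) (q ^ length w₁) q ⟩
    (toℕ a + fromDigits w₁ * q) + fromDigits w₂ * q ^ length (a ∷ w₁) ∎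

  fromDigits-zeros++ : ∀ r (w : List (Fin q)) → fromDigits (replicate r zero ++ w) ≡ fromDigits w * q ^ r
  fromDigits-zeros++ zero    w = sym (*-identityʳ (fromDigits w))
  fromDigits-zeros++ (suc r) w = begin
    fromDigits (replicate r zero ++ w) * q ≡⟨ cong (_* q) (fromDigits-zeros++ r w) ⟩
    fromDigits w * q ^ r * q               ≡⟨ *-assoc (fromDigits w) (q ^ r) q ⟩
    fromDigits w * (q ^ r * q)             ≡⟨ cong (fromDigits w *_) (*-comm (q ^ r) q) ⟩
    fromDigits w * q ^ suc r               ∎

  fromDigits-splice : ∀ (w₁ : List (Fin q)) r w₂ →
                      fromDigits (w₁ ++ replicate r zero ++ w₂) ≡ q ^ (length w₁ + r) * fromDigits w₂ + fromDigits w₁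
  fromDigits-splice w₁ r w₂ = begin
    fromDigits (w₁ ++ replicate r zero ++ w₂)                  ≡⟨ fromDigits-++ w₁ _ ⟩
    fromDigits w₁ + fromDigits (replicate r zero ++ w₂) * q ^ l ≡⟨ cong (λ n → fromDigits w₁ + n * q ^ l) (fromDigits-zeros++ r w₂) ⟩
    fromDigits w₁ + fromDigits w₂ * q ^ r * q ^ l              ≡⟨ solve 4 (λ x y Qr Ql → x :+ y :* Qr :* Ql := Ql :* Qr :* y :+ x)
                                                                    refl (fromDigits w₁) (fromDigits w₂) (q ^ r) (q ^ l) ⟩
    q ^ l * q ^ r * fromDigits w₂ + fromDigits w₁              ≡⟨ cong (λ n → n * fromDigits w₂ + fromDigits w₁) (^-distribˡ-+-* q l r) ⟨
    q ^ (l + r) * fromDigits w₂ + fromDigits w₁                ∎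
    where l = length w₁

  toℕ-mod+div : ∀ n → toℕ (n mod q) + n / q * q ≡ n
  toℕ-mod+div n = trans (cong (_+ n / q * q) (toℕ-fromℕ< (m%n<n n q))) (sym (m≡m%n+[m/n]*n n q))

  digit-mod : ∀ (a : Fin q) n → (toℕ a + n * q) mod q ≡ a
  digit-mod a n = toℕ-injective (begin
    toℕ ((toℕ a + n * q) mod q) ≡⟨ toℕ-fromℕ< (m%n<n (toℕ a + n * q) q) ⟩
    (toℕ a + n * q) % q         ≡⟨ [m+kn]%n≡m%n (toℕ a) n q ⟩
    toℕ a % q                   ≡⟨ m<n⇒m%n≡m (toℕ<n a) ⟩
    toℕ a                       ∎)

  digit-div : ∀ (a : Fin q) n → (toℕ a + n * q) / q ≡ n
  digit-div a n = begin
    (toℕ a + n * q) / q      ≡⟨ +-distrib-/-∣ʳ (toℕ a) (n∣m*n n) ⟩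
    toℕ a / q + n * q / q    ≡⟨ cong₂ _+_ (m<n⇒m/n≡0 (toℕ<n a)) (m*n/n≡m n q) ⟩
    n                        ∎

  quotient-shrinks : ∀ n → suc n / q ≤ n
  quotient-shrinks n = s≤s⁻¹ (m/n<m (suc n) q (s≤s (s≤s z≤n)))

  digitsFuel-empty : ∀ k → digitsFuel q k 0 ≡ []
  digitsFuel-empty zero    = refl
  digitsFuel-empty (suc k) = refl

  digitsFuel-irrelevant : ∀ {k k′} n → n ≤ k → n ≤ k′ → digitsFuel q k n ≡ digitsFuel q k′ n
  digitsFuel-irrelevant {k} {k′} zero _ _ = trans (digitsFuel-empty k) (sym (digitsFuel-empty k′))
  digitsFuel-irrelevant (suc n) (s≤s n≤k) (s≤s n≤k′) =
    cong (suc n mod q ∷_) (digitsFuel-irrelevant (suc n / q)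
      (≤-trans (quotient-shrinks n) n≤k) (≤-trans (quotient-shrinks n) n≤k′))

  fromDigits-digitsFuel : ∀ k n → n ≤ k → fromDigits (digitsFuel q k n) ≡ n
  fromDigits-digitsFuel k       zero    _         = cong fromDigits (digitsFuel-empty k)
  fromDigits-digitsFuel (suc k) (suc n) (s≤s n≤k) = trans
    (cong (λ m → toℕ (suc n mod q) + m * q) (fromDigits-digitsFuel k (suc n / q) (≤-trans (quotient-shrinks n) n≤k)))
    (toℕ-mod+div (suc n))

  fromDigits-digits : ∀ n → fromDigits (digits q q≥2 n) ≡ n
  fromDigits-digits n = fromDigits-digitsFuel n n ≤-refl

  digits-suc : ∀ m → digits q q≥2 (suc m) ≡ (suc m mod q) ∷ digits q q≥2 (suc m / q)
  digits-suc m = cong (suc m mod q ∷_) (digitsFuel-irrelevant (suc m / q) (quotient-shrinks m) ≤-refl)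

  digits-∷ : ∀ {m} a (w : List (Fin q)) → fromDigits (a ∷ w) ≡ suc m →
             digits q q≥2 (suc m) ≡ a ∷ digits q q≥2 (fromDigits w)
  digits-∷ {m} a w eq = trans (digits-suc m) (cong₂ (λ d n → d ∷ digits q q≥2 n)
    (trans (cong (_mod q) (sym eq)) (digit-mod a (fromDigits w)))
    (trans (cong (_/ q) (sym eq)) (digit-div a (fromDigits w))))

  fromDigits-∷≡0 : ∀ a (w : List (Fin q)) → fromDigits (a ∷ w) ≡ 0 → a ≡ zero × fromDigits w ≡ 0
  fromDigits-∷≡0 a w eq =
    toℕ-injective (m+n≡0⇒m≡0 (toℕ a) eq) , m*n≡0⇒m≡0 (fromDigits w) q (m+n≡0⇒n≡0 (toℕ a) eq)

  paddedDigits : ℕ → ℕ → List (Fin q)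
  paddedDigits zero    b = []
  paddedDigits (suc k) b = (b mod q) ∷ paddedDigits k (b / q)

  length-paddedDigits : ∀ k b → length (paddedDigits k b) ≡ k
  length-paddedDigits zero    b = refl
  length-paddedDigits (suc k) b = cong suc (length-paddedDigits k (b / q))

  fromDigits-paddedDigits : ∀ k b → b < q ^ k → fromDigits (paddedDigits k b) ≡ b
  fromDigits-paddedDigits zero    b b<1 = sym (n<1⇒n≡0 b<1)
  fromDigits-paddedDigits (suc k) b b<q^[1+k] = trans
    (cong (λ m → toℕ (b mod q) + m * q) (fromDigits-paddedDigits k (b / q) (m<n*o⇒m/o<n b<q^k*q)))
    (toℕ-mod+div b)
    where
    b<q^k*q : b < q ^ k * q
    b<q^k*q = ≤-trans b<q^[1+k] (≤-reflexive (*-comm q (q ^ k)))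

module QuasiAdditivity {c ℓ} (R : CommutativeRing c ℓ) (q′ : ℕ) where
  open CommutativeRing R hiding (zero) renaming (Carrier to K)
  open LinAlg R
  open MatrixAlgebra R
  open Digits q′
  open import Data.Vec.Functional.Relation.Binary.Equality.Setoid setoid
    using (≋-refl; ≋-reflexive; ≋-sym; ≋-trans)
  open import Relation.Binary.Reasoning.Setoid setoid

  module _ {d : ℕ} (u v : Vector d) (M : Fin q → Matrix d) (f : ℕ → K)
           (represents : ∀ n → f n ≈ u · Words.colMul M (digits q q≥2 n) v)
           (M₀v≋v : (M zero *ᵛ v) ≋ v) (r : ℕ) where
    open Words M
    open WordAlgebra M

    Z : Matrix d
    Z = M zero ^ᴹ r

    open WordConditions M u v Z (^ᴹ-fixes (M zero) M₀v≋v r)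
      using (WordAdditive; Conditions; wordAdditive⇔conditions)

    colMul-fromDigits≡0 : ∀ w → fromDigits w ≡ 0 → colMul w v ≋ v
    colMul-fromDigits≡0 []      _  = ≋-refl
    colMul-fromDigits≡0 (a ∷ w) eq with fromDigits-∷≡0 a w eq
    ... | ≡.refl , w≡0 = ≋-trans (*ᵛ-cong (M zero) (colMul-fromDigits≡0 w w≡0)) M₀v≋v

    colMul-digits-fromDigits : ∀ w → colMul (digits q q≥2 (fromDigits w)) v ≋ colMul w v
    colMul-digits-fromDigits []      = ≋-refl
    colMul-digits-fromDigits (a ∷ w) with fromDigits (a ∷ w) in eq
    ... | zero  = ≋-sym (colMul-fromDigits≡0 (a ∷ w) eq)
    ... | suc m = ≋-trans (≋-reflexive (≡.cong (λ w′ → colMul w′ v) (digits-∷ a w eq)))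
                          (*ᵛ-cong (M a) (colMul-digits-fromDigits w))

    f-fromDigits : ∀ w → f (fromDigits w) ≈ u · colMul w v
    f-fromDigits w = trans (represents _) (·-cong ≋-refl (colMul-digits-fromDigits w))

    f-splice : ∀ w₁ w₂ → f (q ℕ.^ (length w₁ ℕ.+ r) ℕ.* fromDigits w₂ ℕ.+ fromDigits w₁)
                         ≈ u · colMul w₁ (Z *ᵛ colMul w₂ v)
    f-splice w₁ w₂ = begin
      f (q ℕ.^ (length w₁ ℕ.+ r) ℕ.* fromDigits w₂ ℕ.+ fromDigits w₁)
        ≡⟨ ≡.cong f (fromDigits-splice w₁ r w₂) ⟨
      f (fromDigits (w₁ ++ replicate r zero ++ w₂))
        ≈⟨ f-fromDigits (w₁ ++ replicate r zero ++ w₂) ⟩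
      u · colMul (w₁ ++ replicate r zero ++ w₂) v
        ≡⟨ ≡.cong (u ·_) (≡.trans (colMul-++ w₁ _ v) (≡.cong (colMul w₁) (colMul-++ (replicate r zero) w₂ v))) ⟩
      u · colMul w₁ (colMul (replicate r zero) (colMul w₂ v))
        ≈⟨ ·-cong ≋-refl (colMul-cong w₁ (colMul-replicate r zero (colMul w₂ v))) ⟩
      u · colMul w₁ (Z *ᵛ colMul w₂ v) ∎

    quasiAdditive⇒wordAdditive : QuasiAdditive q f r → WordAdditive
    quasiAdditive⇒wordAdditive qa w₁ w₂ = begin
      u · colMul w₁ (Z *ᵛ colMul w₂ v)
        ≈⟨ f-splice w₁ w₂ ⟨
      f (q ℕ.^ (length w₁ ℕ.+ r) ℕ.* fromDigits w₂ ℕ.+ fromDigits w₁)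
        ≈⟨ qa (fromDigits w₂) (fromDigits w₁) (length w₁) (fromDigits-bound w₁) ⟩
      f (fromDigits w₂) + f (fromDigits w₁)
        ≈⟨ +-comm _ _ ⟩
      f (fromDigits w₁) + f (fromDigits w₂)
        ≈⟨ +-cong (f-fromDigits w₁) (f-fromDigits w₂) ⟩
      u · colMul w₁ v + u · colMul w₂ v ∎

    wordAdditive⇒quasiAdditive : WordAdditive → QuasiAdditive q f r
    wordAdditive⇒quasiAdditive add a b k b<q^k = begin
      f (q ℕ.^ (k ℕ.+ r) ℕ.* a ℕ.+ b)                                   ≡⟨ ≡.cong f splice≡ ⟨
      f (q ℕ.^ (length w₁ ℕ.+ r) ℕ.* fromDigits w₂ ℕ.+ fromDigits w₁)   ≈⟨ f-splice w₁ w₂ ⟩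
      u · colMul w₁ (Z *ᵛ colMul w₂ v)                                  ≈⟨ add w₁ w₂ ⟩
      u · colMul w₁ v + u · colMul w₂ v                                 ≈⟨ +-cong (f-fromDigits w₁) (represents a) ⟨
      f (fromDigits w₁) + f a                                           ≡⟨ ≡.cong (λ n → f n + f a) (fromDigits-paddedDigits k b b<q^k) ⟩
      f b + f a                                                         ≈⟨ +-comm _ _ ⟩
      f a + f b                                                         ∎
      where
      w₁ = paddedDigits k b
      w₂ = digits q q≥2 a
      splice≡ : q ℕ.^ (length w₁ ℕ.+ r) ℕ.* fromDigits w₂ ℕ.+ fromDigits w₁ ≡ q ℕ.^ (k ℕ.+ r) ℕ.* a ℕ.+ b
      splice≡ rewrite length-paddedDigits k b | fromDigits-digits a | fromDigits-paddedDigits k b b<q^k = ≡.refl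

    quasiAdditive⇔wordAdditive : QuasiAdditive q f r ⇔ WordAdditive
    quasiAdditive⇔wordAdditive = mk⇔ quasiAdditive⇒wordAdditive wordAdditive⇒quasiAdditive

    quasiAdditive⇔conditions : QuasiAdditive q f r ⇔ Conditions
    quasiAdditive⇔conditions = wordAdditive⇔conditions ⇔-∘ quasiAdditive⇔wordAdditive

theorem9 : ∀ {c ℓ} (F : Field c ℓ) →
    let open Field F
        open LinAlg commutativeRing
    in (q : ℕ) (q≥2 : 2 ≤ q) (d : ℕ) (u v : Vector d) (M : Fin q → Matrix d)
       (f : ℕ → Carrier) →
       ((n : ℕ) → f n ≈ (u · Words.colMul M (digits q q≥2 n) v)) →
       (M (zeroDigit q q≥2) *ᵛ v) ≋ v →
       (r : ℕ) →
       QuasiAdditive q f r ⇔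
         ( (u · v) ≈ 0#
         × (∀ x → Words.InU M u x → (x · (((M (zeroDigit q q≥2) ^ᴹ r) ⊟ idM) *ᵛ v)) ≈ 0#)
         × (∀ y → Words.InV M v y → (u · (((M (zeroDigit q q≥2) ^ᴹ r) ⊟ idM) *ᵛ y)) ≈ 0#)
         × (∀ x y → Words.InU M u x → Words.InV M v y →
              (x · ((M (zeroDigit q q≥2) ^ᴹ r) *ᵛ y)) ≈ 0#) )
theorem9 F (suc (suc q′)) (s≤s (s≤s z≤n)) d =
  QuasiAdditivity.quasiAdditive⇔conditions (Field.commutativeRing F) q′
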